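{- Let $\ell\ge0$ be an integer and $x_0,\dots,x_\ell$ indeterminates. For every integer $k\ge1$, the $\mathbb{Z}$-module of homogeneous polynomials of degree $k$ in $\mathbb{Z}[x_0,\dots,x_\ell]$ is generated by the minors of order $k$ of the $k\times(k+\ell)$ matrix $R(k,\ell)$ whose $i$-th row ($1\le i\le k$) has entries $x_0,x_1,\dots,x_\ell$ in columns $i,i+1,\dots,i+\ell$ and zeros elsewhere. -}

module Defs where

open import Data.Nat as ℕ using (ℕ; zero; suc; _≤ᵇ_; _∸_)
open import Data.Integer as ℤ using (ℤ; 0ℤ; 1ℤ; -1ℤ)
open import Data.Fin as Fin using (Fin; toℕ; punchIn)
open import Data.Vec as Vec using (Vec; tabulate; zipWith; replicate)
import Data.Vec.Properties as VecP
open import Data.List as List using (List; []; _∷_; _++_; map; concatMap; foldr; allFin)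
open import Data.Product using (_×_; _,_)
open import Data.Bool using (if_then_else_; _∧_)
open import Relation.Nullary.Decidable using (⌊_⌋)
open import Relation.Binary.PropositionalEquality using (_≡_)
open import Relation.Nullary using (¬_)

Mono : ℕ → Set
Mono ℓ = Vec ℕ (suc ℓ)

-- Polynomials in ℤ[x₀,…,x_ℓ] as formal finite sums (coefficient, monomial).
-- Two such lists denote the same polynomial iff they have the same
-- coefficient function `coeff` (see _≈P_).
Poly : ℕ → Set
Poly ℓ = List (ℤ × Mono ℓ)

_≟M_ : ∀ {ℓ} (m n : Mono ℓ) → Relation.Nullary.Dec (m ≡ n)
_≟M_ = VecP.≡-dec ℕ._≟_

coeff : ∀ {ℓ} → Poly ℓ → Mono ℓ → ℤ
coeff []             m = 0ℤ
coeff ((a , m') ∷ p) m = (if ⌊ m' ≟M m ⌋ then a else 0ℤ) ℤ.+ coeff p m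

_≈P_ : ∀ {ℓ} → Poly ℓ → Poly ℓ → Set
p ≈P q = ∀ m → coeff p m ≡ coeff q m

zeroP : ∀ {ℓ} → Poly ℓ
zeroP = []

oneP : ∀ {ℓ} → Poly ℓ
oneP = (1ℤ , replicate _ 0) ∷ []

_+P_ : ∀ {ℓ} → Poly ℓ → Poly ℓ → Poly ℓ
_+P_ = _++_

scale : ∀ {ℓ} → ℤ → Poly ℓ → Poly ℓ
scale a = map (λ { (b , m) → (a ℤ.* b , m) })

_*P_ : ∀ {ℓ} → Poly ℓ → Poly ℓ → Poly ℓ
p *P q = concatMap (λ { (a , m) → map (λ { (b , n) → (a ℤ.* b , zipWith ℕ._+_ m n) }) q }) p

sumP : ∀ {ℓ} → List (Poly ℓ) → Poly ℓ
sumP = foldr _+P_ zeroP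

var : ∀ {ℓ} → ℕ → Poly ℓ
var {ℓ} d = (1ℤ , tabulate (λ j → if ⌊ toℕ j ℕ.≟ d ⌋ then 1 else 0)) ∷ []

sgn : ℕ → ℤ
sgn zero          = 1ℤ
sgn (suc zero)    = -1ℤ
sgn (suc (suc n)) = sgn n

det : ∀ {ℓ} (n : ℕ) → (Fin n → Fin n → Poly ℓ) → Poly ℓ
det zero    M = oneP
det (suc n) M = sumP (map (λ j → scale (sgn (toℕ j))
                  (M Fin.zero j *P det n (λ r c → M (Fin.suc r) (punchIn j c))))
                  (allFin (suc n)))

-- The k×(k+ℓ) matrix R(k,ℓ) (0-indexed): row i has x₀,…,x_ℓ in columns i,…,i+ℓ, zeros elsewhere.
R : (k ℓ : ℕ) → Fin k → Fin (k ℕ.+ ℓ) → Poly ℓ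
R k ℓ i c = if (toℕ i ≤ᵇ toℕ c) ∧ ((toℕ c ∸ toℕ i) ≤ᵇ ℓ) then var (toℕ c ∸ toℕ i) else zeroP

-- column selections for minors of order k: strictly increasing maps Fin k → Fin (k+ℓ)
StrictlyIncreasing : ∀ {k m} → (Fin k → Fin m) → Set
StrictlyIncreasing σ = ∀ i j → i Fin.< j → σ i Fin.< σ j

minor : (k ℓ : ℕ) → (Fin k → Fin (k ℕ.+ ℓ)) → Poly ℓ
minor k ℓ σ = det k (λ r c → R k ℓ r (σ c))

Homogeneous : ∀ {ℓ} → ℕ → Poly ℓ → Set
Homogeneous k p = ∀ m → ¬ (coeff p m ≡ 0ℤ) → Vec.sum m ≡ k

{-# OPTIONS --safe #-}
-- Order the monomials lexicographically with x₀ most significant.  Call a set of columns τ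
-- of R(k,ℓ) admissible if the diagonal entries x_{τ c − c} of the minor on τ are all nonzero.
-- Expanding this minor along its first row, the term through the first column is x_{τ 0}
-- times an admissible minor of size k − 1, and every other term contains a variable x_i with
-- i < τ 0, which the diagonal product does not.  By induction the diagonal product is the
-- smallest monomial of the minor, with coefficient 1.  Every monomial of degree k is the
-- diagonal product of some admissible τ (list its variables in increasing order), so
-- the minors are unitriangular over the monomials of degree k, and induction along the
-- order writes each monomial, hence each homogeneous polynomial, as a ℤ-combination of minors.
module Submission where

open import Defs
open import Data.Bool using (true; false; if_then_else_; _∧_; T)
open import Data.Empty using (⊥-elim)
open import Data.Fin as Fin using (Fin; toℕ; punchIn; punchOut)
import Data.Fin.Properties as FinP
open import Data.Integer as ℤ using (ℤ; 0ℤ; 1ℤ; -1ℤ)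
import Data.Integer.Properties as ℤP
open import Data.Integer.Tactic.RingSolver using (solve-∀)
open import Data.List as List using (List; []; _∷_; _++_; map; allFin; filter)
import Data.List.Properties as LP
open import Data.List.Relation.Unary.All as All using (All; []; _∷_)
import Data.List.Relation.Unary.All.Properties as AllP
open import Data.Nat as ℕ using (ℕ; zero; suc; _+_; _*_; _^_; _∸_; _≤_; _<_; _≤ᵇ_; z≤n; s≤s)
open import Data.Nat.Induction using (<-wellFounded)
import Data.Nat.Properties as ℕP
open import Algebra.Properties.CommutativeSemigroup ℕP.+-commutativeSemigroup using (interchange)
open import Data.Product using (_×_; _,_; ∃; Σ; proj₁; proj₂)
open import Data.Sum using (_⊎_; inj₁; inj₂)
open import Data.Unit using (⊤; tt)
open import Data.Vec as Vec using (Vec; []; _∷_; lookup; replicate; zipWith)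
import Data.Vec.Properties as VecP
open import Function using (_∘_)
open import Induction.WellFounded using (Acc; acc)
open import Relation.Binary.PropositionalEquality
open import Relation.Nullary using (yes; no; ¬?)
open import Relation.Nullary.Decidable using (⌊_⌋)
open import Relation.Unary using (Decidable)

infixl 7 _·_
_·_ : ∀ {n} → Vec ℕ n → Vec ℕ n → Vec ℕ n
_·_ = zipWith _+_

unit : ∀ {n} → ℕ → Vec ℕ n
unit {zero}  _       = []
unit {suc n} zero    = 1 ∷ replicate n 0
unit {suc n} (suc d) = 0 ∷ unit d

OfDegree : ∀ {n} → ℕ → Vec ℕ n → Set
OfDegree k m = Vec.sum m ≡ k

sum-· : ∀ {n} (u v : Vec ℕ n) → Vec.sum (u · v) ≡ Vec.sum u + Vec.sum v
sum-· []      []      = refl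
sum-· (x ∷ u) (y ∷ v) = trans (cong (x + y +_) (sum-· u v)) (interchange x y (Vec.sum u) (Vec.sum v))

sum-replicate-0 : ∀ n → Vec.sum (replicate n 0) ≡ 0
sum-replicate-0 zero    = refl
sum-replicate-0 (suc n) = sum-replicate-0 n

sum-unit : ∀ {n} d → d < n → Vec.sum (unit {n} d) ≡ 1
sum-unit {suc n} zero    _         = cong suc (sum-replicate-0 n)
sum-unit {suc n} (suc d) (s≤s d<n) = sum-unit d d<n

sum≡0⇒replicate-0 : ∀ {n} (v : Vec ℕ n) → Vec.sum v ≡ 0 → v ≡ replicate n 0
sum≡0⇒replicate-0 []         _   = refl
sum≡0⇒replicate-0 (zero ∷ v) Σ≡0 = cong (0 ∷_) (sum≡0⇒replicate-0 v Σ≡0)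

replicate-0-· : ∀ {n} (v : Vec ℕ n) → replicate n 0 · v ≡ v
replicate-0-· []      = refl
replicate-0-· (x ∷ v) = cong (x ∷_) (replicate-0-· v)

·-cancelˡ : ∀ {n} (u v w : Vec ℕ n) → u · v ≡ u · w → v ≡ w
·-cancelˡ []      []      []      _  = refl
·-cancelˡ (x ∷ u) (y ∷ v) (z ∷ w) eq =
  cong₂ _∷_ (ℕP.+-cancelˡ-≡ x y z (cong Vec.head eq)) (·-cancelˡ u v w (cong Vec.tail eq))

lookup-·ʳ : ∀ {n} (u v : Vec ℕ n) i → lookup v i ≤ lookup (u · v) i
lookup-·ʳ u v i rewrite VecP.lookup-zipWith _+_ i u v = ℕP.m≤n+m (lookup v i) (lookup u i)

lookup≤sum : ∀ {n} (v : Vec ℕ n) i → lookup v i ≤ Vec.sum v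
lookup≤sum (x ∷ v) Fin.zero    = ℕP.m≤m+n x _
lookup≤sum (x ∷ v) (Fin.suc i) = ℕP.≤-trans (lookup≤sum v i) (ℕP.m≤n+m _ x)

lookup-unit-< : ∀ {n} d (i : Fin n) → toℕ i < d → lookup (unit d) i ≡ 0
lookup-unit-< (suc d) Fin.zero    _         = refl
lookup-unit-< (suc d) (Fin.suc i) (s≤s i<d) = lookup-unit-< d i i<d

peel-lowest : ∀ {n} (v : Vec ℕ n) → 0 < Vec.sum v →
              Σ (Fin n) λ b → Σ (Vec ℕ n) λ w →
                v ≡ unit (toℕ b) · w × 0 < lookup v b × (∀ i → toℕ i < toℕ b → lookup w i ≡ 0)
peel-lowest (suc x ∷ v) _ = Fin.zero , x ∷ v , cong (suc x ∷_) (sym (replicate-0-· v)) , s≤s z≤n , λ _ ()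
peel-lowest (zero ∷ v) positive with peel-lowest v positive
... | b , w , v≡ , v[b]>0 , w-zeros =
  Fin.suc b , 0 ∷ w , cong (0 ∷_) v≡ , v[b]>0 , λ { Fin.zero _ → refl ; (Fin.suc i) (s≤s i<b) → w-zeros i i<b }

UsesVarBelow : ∀ {n} → ℕ → Vec ℕ n → Set
UsesVarBelow t v = ∃ λ i → toℕ i < t × 0 < lookup v i

usesVarBelow-unit· : ∀ {n} d (v : Vec ℕ n) → d < n → UsesVarBelow (suc d) (unit d · v)
usesVarBelow-unit· zero    (x ∷ v) _         = Fin.zero , s≤s z≤n , s≤s z≤n
usesVarBelow-unit· (suc d) (x ∷ v) (s≤s d<n) with usesVarBelow-unit· d v d<n
... | i , i<d , positive = Fin.suc i , s≤s i<d , positive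

usesVarBelow-·ʳ : ∀ {n t} (u : Vec ℕ n) {v} → UsesVarBelow t v → UsesVarBelow t (u · v)
usesVarBelow-·ʳ u {v} (i , i<t , positive) = i , i<t , ℕP.<-≤-trans positive (lookup-·ʳ u v i)

usesVarBelow-≤ : ∀ {n s t} {v : Vec ℕ n} → s ≤ t → UsesVarBelow s v → UsesVarBelow t v
usesVarBelow-≤ s≤t (i , i<s , positive) = i , ℕP.<-≤-trans i<s s≤t , positive

-- The lexicographic order

-- For entries below B, comparing codes is comparing the vectors lexicographically.
enc : ∀ {n} → ℕ → Vec ℕ n → ℕ
enc B []               = 0
enc {suc n} B (x ∷ xs) = x * B ^ n + enc B xs

enc-· : ∀ {n} B (u v : Vec ℕ n) → enc B (u · v) ≡ enc B u + enc B v
enc-· B [] [] = refl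
enc-· {suc n} B (x ∷ u) (y ∷ v) = begin
    (x + y) * B ^ n + enc B (u · v)                 ≡⟨ cong₂ _+_ (ℕP.*-distribʳ-+ (B ^ n) x y) (enc-· B u v) ⟩
    (x * B ^ n + y * B ^ n) + (enc B u + enc B v)   ≡⟨ interchange (x * B ^ n) (y * B ^ n) (enc B u) (enc B v) ⟩
    (x * B ^ n + enc B u) + (y * B ^ n + enc B v)   ∎
  where open ≡-Reasoning

enc-bound : ∀ {n} B (v : Vec ℕ n) → (∀ i → lookup v i < B) → enc B v < B ^ n
enc-bound B []              _      = s≤s z≤n
enc-bound {suc n} B (x ∷ v) digits = begin-strict
    x * B ^ n + enc B v   <⟨ ℕP.+-monoʳ-< (x * B ^ n) (enc-bound B v (digits ∘ Fin.suc)) ⟩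
    x * B ^ n + B ^ n     ≡⟨ ℕP.+-comm (x * B ^ n) (B ^ n) ⟩
    suc x * B ^ n         ≤⟨ ℕP.*-monoˡ-≤ (B ^ n) (digits Fin.zero) ⟩
    B * B ^ n             ∎
  where open ℕP.≤-Reasoning

enc-<-leading-zeros : ∀ {n} B (w u : Vec ℕ n) → (∀ i → lookup w i < B) →
                      ∀ i → 0 < lookup u i → (∀ j → toℕ j ≤ toℕ i → lookup w j ≡ 0) → enc B w < enc B u
enc-<-leading-zeros {suc n} B (y ∷ w) (suc x ∷ u) digits Fin.zero _ zeros rewrite zeros Fin.zero z≤n = begin-strict
    enc B w                  <⟨ enc-bound B w (digits ∘ Fin.suc) ⟩
    B ^ n                    ≤⟨ ℕP.m≤m+n (B ^ n) (x * B ^ n) ⟩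
    suc x * B ^ n            ≤⟨ ℕP.m≤m+n _ (enc B u) ⟩
    suc x * B ^ n + enc B u  ∎
  where open ℕP.≤-Reasoning
enc-<-leading-zeros {suc n} B (y ∷ w) (x ∷ u) digits (Fin.suc i) positive zeros rewrite zeros Fin.zero z≤n =
  ℕP.<-≤-trans (enc-<-leading-zeros B w u (digits ∘ Fin.suc) i positive (λ j j≤i → zeros (Fin.suc j) (s≤s j≤i)))
               (ℕP.m≤n+m (enc B u) (x * B ^ n))

enc-<-usesVarBelow : ∀ {n} B {t} (w u : Vec ℕ n) → (∀ i → lookup w i < B) →
                     (∀ i → toℕ i < t → lookup w i ≡ 0) → UsesVarBelow t u → enc B w < enc B u
enc-<-usesVarBelow B w u digits zeros (i , i<t , positive) =
  enc-<-leading-zeros B w u digits i positive (λ j j≤i → zeros j (ℕP.≤-<-trans j≤i i<t))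

digits-< : ∀ {n k B} (v : Vec ℕ n) → OfDegree k v → k < B → ∀ i → lookup v i < B
digits-< v v-deg k<B i = ℕP.≤-<-trans (ℕP.≤-trans (lookup≤sum v i) (ℕP.≤-reflexive v-deg)) k<B

mono : ∀ {ℓ} → Mono ℓ → Poly ℓ
mono m = (1ℤ , m) ∷ []

≟-suc : ∀ a d → ⌊ suc a ℕ.≟ suc d ⌋ ≡ ⌊ a ℕ.≟ d ⌋
≟-suc a d with a ℕ.≟ d | suc a ℕ.≟ suc d
... | yes _ | yes _ = refl
... | no  _ | no  _ = refl
... | yes a≡d | no sa≢sd = ⊥-elim (sa≢sd (cong suc a≡d))
... | no a≢d  | yes sa≡sd = ⊥-elim (a≢d (ℕP.suc-injective sa≡sd))

tabulate≡unit : ∀ {n} d → Vec.tabulate {n = n} (λ j → if ⌊ toℕ j ℕ.≟ d ⌋ then 1 else 0) ≡ unit d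
tabulate≡unit {zero}  d       = refl
tabulate≡unit {suc n} zero    = cong (1 ∷_) (tabulate-0 n)
  where
  tabulate-0 : ∀ n → Vec.tabulate {n = n} (λ _ → 0) ≡ replicate n 0
  tabulate-0 zero    = refl
  tabulate-0 (suc n) = cong (0 ∷_) (tabulate-0 n)
tabulate≡unit {suc n} (suc d) =
  cong (0 ∷_) (trans (VecP.tabulate-cong (λ j → cong (if_then 1 else 0) (≟-suc (toℕ j) d))) (tabulate≡unit d))

var≡mono-unit : ∀ {ℓ} d → var {ℓ} d ≡ mono (unit d)
var≡mono-unit d = cong (λ m → (1ℤ , m) ∷ []) (tabulate≡unit d)

AllMonomials : ∀ {ℓ} → (Mono ℓ → Set) → Poly ℓ → Set
AllMonomials P p = All (P ∘ proj₂) p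

AllMonomials-scale : ∀ {ℓ} {P : Mono ℓ → Set} a {p : Poly ℓ} → AllMonomials P p → AllMonomials P (scale a p)
AllMonomials-scale a = AllP.map⁺

AllMonomials-*P : ∀ {ℓ} {P Q S : Mono ℓ → Set} {p q : Poly ℓ} → AllMonomials P p → AllMonomials Q q →
           (∀ {u v} → P u → Q v → S (u · v)) → AllMonomials S (p *P q)
AllMonomials-*P []        _  _ = []
AllMonomials-*P (Pu ∷ Pp) Qq f = AllP.++⁺ (AllP.map⁺ (All.map (f Pu) Qq)) (AllMonomials-*P Pp Qq f)

AllMonomials-sum-allFin : ∀ {ℓ n} {P : Mono ℓ → Set} {f : Fin n → Poly ℓ} → (∀ j → AllMonomials P (f j)) →
                   AllMonomials P (sumP (map f (allFin n)))
AllMonomials-sum-allFin terms = AllP.concat⁺ (AllP.map⁺ (AllP.tabulate⁺ terms))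

coeff-++ : ∀ {ℓ} (p q : Poly ℓ) m → coeff (p ++ q) m ≡ coeff p m ℤ.+ coeff q m
coeff-++ []            q m = sym (ℤP.+-identityˡ _)
coeff-++ ((a , v) ∷ p) q m =
  trans (cong (λ z → head ℤ.+ z) (coeff-++ p q m)) (sym (ℤP.+-assoc head (coeff p m) (coeff q m)))
  where
  head : ℤ
  head = if ⌊ v ≟M m ⌋ then a else 0ℤ

coeff-scale : ∀ {ℓ} a (p : Poly ℓ) m → coeff (scale a p) m ≡ a ℤ.* coeff p m
coeff-scale a []            m = sym (ℤP.*-zeroʳ a)
coeff-scale a ((b , v) ∷ p) m with v ≟M m
... | yes _ = trans (cong (λ z → a ℤ.* b ℤ.+ z) (coeff-scale a p m)) (sym (ℤP.*-distribˡ-+ a b _))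
... | no  _ = trans (ℤP.+-identityˡ _) (trans (coeff-scale a p m) (cong (a ℤ.*_) (sym (ℤP.+-identityˡ _))))

coeff-absent : ∀ {ℓ} {p : Poly ℓ} {m} → AllMonomials (_≢ m) p → coeff p m ≡ 0ℤ
coeff-absent []                             = refl
coeff-absent {p = (a , v) ∷ p} {m} (v≢m ∷ rest) with v ≟M m
... | yes v≡m = ⊥-elim (v≢m v≡m)
... | no  _   = trans (ℤP.+-identityˡ _) (coeff-absent rest)

coeff-filter : ∀ {ℓ} {P : Mono ℓ → Set} (P? : Decidable P) (p : Poly ℓ) {m} → P m →
               coeff (filter (P? ∘ proj₂) p) m ≡ coeff p m
coeff-filter P? []            Pm = refl
coeff-filter P? ((a , v) ∷ p) {m} Pm with P? v
... | yes _  = cong (λ z → (if ⌊ v ≟M m ⌋ then a else 0ℤ) ℤ.+ z) (coeff-filter P? p Pm)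
... | no ¬Pv with v ≟M m
...   | yes refl = ⊥-elim (¬Pv Pm)
...   | no  _    = trans (coeff-filter P? p Pm) (sym (ℤP.+-identityˡ _))

coeff-mono-*P : ∀ {ℓ} (w : Mono ℓ) p u → coeff (mono w *P p) (w · u) ≡ coeff p u
coeff-mono-*P w []            u = refl
coeff-mono-*P w ((b , v) ∷ p) u = cong₂ ℤ._+_ head (coeff-mono-*P w p u)
  where
  head : (if ⌊ (w · v) ≟M (w · u) ⌋ then 1ℤ ℤ.* b else 0ℤ) ≡ (if ⌊ v ≟M u ⌋ then b else 0ℤ)
  head with v ≟M u | (w · v) ≟M (w · u)
  ... | yes _   | yes _  = ℤP.*-identityˡ b
  ... | yes v≡u | no wv≢wu = ⊥-elim (wv≢wu (cong (w ·_) v≡u))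
  ... | no v≢u  | yes wv≡wu = ⊥-elim (v≢u (·-cancelˡ w v u wv≡wu))
  ... | no _    | no _   = refl

allMonomials⇒homogeneous : ∀ {ℓ k} {p : Poly ℓ} → AllMonomials (OfDegree k) p → Homogeneous k p
allMonomials⇒homogeneous {k = k} {p} degrees m coeff≢0 with Vec.sum m ℕ.≟ k
... | yes m-deg = m-deg
... | no  m-deg =
  ⊥-elim (coeff≢0 (coeff-absent (All.map (λ v-deg v≡m → m-deg (subst (OfDegree k) v≡m v-deg)) degrees)))

erase : ∀ {ℓ} → Mono ℓ → Poly ℓ → Poly ℓ
erase m = filter (λ t → ¬? (proj₂ t ≟M m))

mono≈-erase : ∀ {ℓ} (p : Poly ℓ) {m} → coeff p m ≡ 1ℤ → mono m ≈P (p ++ scale -1ℤ (erase m p))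
mono≈-erase p {m} p[m]≡1 u = begin
    coeff (mono m) u                                ≡⟨ pointwise ⟩
    coeff p u ℤ.+ -1ℤ ℤ.* coeff (erase m p) u       ≡⟨ cong (λ z → coeff p u ℤ.+ z) (coeff-scale -1ℤ (erase m p) u) ⟨
    coeff p u ℤ.+ coeff (scale -1ℤ (erase m p)) u   ≡⟨ coeff-++ p (scale -1ℤ (erase m p)) u ⟨
    coeff (p ++ scale -1ℤ (erase m p)) u            ∎
  where
  open ≡-Reasoning
  pointwise : coeff (mono m) u ≡ coeff p u ℤ.+ -1ℤ ℤ.* coeff (erase m p) u
  pointwise with m ≟M u
  ... | yes refl rewrite p[m]≡1 | coeff-absent {p = erase m p} (AllP.all-filter _ p) = refl
  ... | no  m≢u rewrite coeff-filter (λ v → ¬? (v ≟M m)) p (m≢u ∘ sym) =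
    sym (trans (cong (λ z → coeff p u ℤ.+ z) (ℤP.-1*i≡-i (coeff p u))) (ℤP.+-inverseʳ (coeff p u)))

-- Spans of a family of polynomials

module Span {ℓ} {I : Set} (g : I → Poly ℓ) (Allowed : I → Set) where

  combination : List (ℤ × I) → Poly ℓ
  combination cs = sumP (map (λ c → scale (proj₁ c) (g (proj₂ c))) cs)

  record Spanned (p : Poly ℓ) : Set where
    constructor spanned
    field
      coefficients  : List (ℤ × I)
      allowed       : All (λ c → Allowed (proj₂ c)) coefficients
      ≈-combination : p ≈P combination coefficients

  spanned-≈ : ∀ {p q} → p ≈P q → Spanned q → Spanned p
  spanned-≈ p≈q (spanned cs allowed q≈cs) = spanned cs allowed λ m → trans (p≈q m) (q≈cs m)

  spanned-[] : Spanned []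
  spanned-[] = spanned [] [] λ _ → refl

  spanned-generator : ∀ {i} → Allowed i → Spanned (g i)
  spanned-generator {i} allowed = spanned ((1ℤ , i) ∷ []) (allowed ∷ []) λ m → sym (begin
      coeff (scale 1ℤ (g i) ++ []) m     ≡⟨ coeff-++ (scale 1ℤ (g i)) [] m ⟩
      coeff (scale 1ℤ (g i)) m ℤ.+ 0ℤ    ≡⟨ ℤP.+-identityʳ _ ⟩
      coeff (scale 1ℤ (g i)) m           ≡⟨ coeff-scale 1ℤ (g i) m ⟩
      1ℤ ℤ.* coeff (g i) m               ≡⟨ ℤP.*-identityˡ _ ⟩
      coeff (g i) m                      ∎)
    where open ≡-Reasoning

  combination-++ : ∀ cs ds → combination (cs ++ ds) ≡ combination cs ++ combination ds
  combination-++ cs ds = trans (cong sumP (LP.map-++ _ cs ds)) (sym (LP.concat-++ (map _ cs) (map _ ds)))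

  spanned-++ : ∀ {p q} → Spanned p → Spanned q → Spanned (p ++ q)
  spanned-++ {p} {q} (spanned cs allowed-cs p≈cs) (spanned ds allowed-ds q≈ds) =
    spanned (cs ++ ds) (AllP.++⁺ allowed-cs allowed-ds) λ m → begin
      coeff (p ++ q) m                                      ≡⟨ coeff-++ p q m ⟩
      coeff p m ℤ.+ coeff q m                               ≡⟨ cong₂ ℤ._+_ (p≈cs m) (q≈ds m) ⟩
      coeff (combination cs) m ℤ.+ coeff (combination ds) m ≡⟨ coeff-++ (combination cs) _ m ⟨
      coeff (combination cs ++ combination ds) m            ≡⟨ cong (λ r → coeff r m) (combination-++ cs ds) ⟨
      coeff (combination (cs ++ ds)) m                      ∎
    where open ≡-Reasoning

  scaleAll : ℤ → List (ℤ × I) → List (ℤ × I)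
  scaleAll a = map (λ c → (a ℤ.* proj₁ c , proj₂ c))

  coeff-combination-scaleAll : ∀ a cs m → coeff (combination (scaleAll a cs)) m ≡ a ℤ.* coeff (combination cs) m
  coeff-combination-scaleAll a []            m = sym (ℤP.*-zeroʳ a)
  coeff-combination-scaleAll a ((b , i) ∷ cs) m = begin
      coeff (scale (a ℤ.* b) (g i) ++ combination (scaleAll a cs)) m
        ≡⟨ coeff-++ (scale (a ℤ.* b) (g i)) _ m ⟩
      coeff (scale (a ℤ.* b) (g i)) m ℤ.+ coeff (combination (scaleAll a cs)) m
        ≡⟨ cong₂ ℤ._+_ (coeff-scale (a ℤ.* b) (g i) m) (coeff-combination-scaleAll a cs m) ⟩
      a ℤ.* b ℤ.* coeff (g i) m ℤ.+ a ℤ.* coeff (combination cs) m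
        ≡⟨ distrib a b (coeff (g i) m) (coeff (combination cs) m) ⟩
      a ℤ.* (b ℤ.* coeff (g i) m ℤ.+ coeff (combination cs) m)
        ≡⟨ cong (λ z → a ℤ.* (z ℤ.+ _)) (coeff-scale b (g i) m) ⟨
      a ℤ.* (coeff (scale b (g i)) m ℤ.+ coeff (combination cs) m)
        ≡⟨ cong (a ℤ.*_) (coeff-++ (scale b (g i)) _ m) ⟨
      a ℤ.* coeff (scale b (g i) ++ combination cs) m
        ∎
    where
    open ≡-Reasoning
    distrib : ∀ a b x y → a ℤ.* b ℤ.* x ℤ.+ a ℤ.* y ≡ a ℤ.* (b ℤ.* x ℤ.+ y)
    distrib = solve-∀

  spanned-scale : ∀ a {p} → Spanned p → Spanned (scale a p)
  spanned-scale a {p} (spanned cs allowed p≈cs) = spanned (scaleAll a cs) (AllP.map⁺ allowed) λ m → begin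
      coeff (scale a p) m                   ≡⟨ coeff-scale a p m ⟩
      a ℤ.* coeff p m                       ≡⟨ cong (a ℤ.*_) (p≈cs m) ⟩
      a ℤ.* coeff (combination cs) m        ≡⟨ coeff-combination-scaleAll a cs m ⟨
      coeff (combination (scaleAll a cs)) m ∎
    where open ≡-Reasoning

  spanned-terms : ∀ {p} → AllMonomials (Spanned ∘ mono) p → Spanned p
  spanned-terms {[]}          []       = spanned-[]
  spanned-terms {(a , v) ∷ p} (v∈ ∷ p∈) = spanned-≈ split (spanned-++ (spanned-scale a v∈) (spanned-terms p∈))
    where
    split : ((a , v) ∷ p) ≈P (scale a (mono v) ++ p)
    split m with v ≟M m
    ... | yes _ = cong (ℤ._+ coeff p m) (sym (ℤP.*-identityʳ a))
    ... | no  _ = refl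

  record Pivot (Dom : Mono ℓ → Set) (rank : Mono ℓ → ℕ) (m : Mono ℓ) : Set where
    field
      index   : I
      allowed : Allowed index
      leading : coeff (g index) m ≡ 1ℤ
      lower   : AllMonomials (λ v → Dom v × (v ≡ m ⊎ rank v < rank m)) (g index)

  spanned-by-pivots : (Dom : Mono ℓ → Set) (rank : Mono ℓ → ℕ) → (∀ {m} → Dom m → Pivot Dom rank m) →
                   ∀ {m} → Dom m → Spanned (mono m)
  spanned-by-pivots Dom rank pivot {m} = go m (<-wellFounded (rank m))
    where
    go : ∀ m → Acc _<_ (rank m) → Dom m → Spanned (mono m)
    go m (acc below) m∈Dom =
      spanned-≈ (mono≈-erase (g index) leading)
        (spanned-++ (spanned-generator allowed) (spanned-scale -1ℤ (spanned-terms rest)))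
      where
      open Pivot (pivot m∈Dom)
      lower-spanned : ∀ {v} → (Dom v × (v ≡ m ⊎ rank v < rank m)) × v ≢ m → Spanned (mono v)
      lower-spanned ((_     , inj₁ v≡m) , v≢m) = ⊥-elim (v≢m v≡m)
      lower-spanned ((v∈Dom , inj₂ v<m) , _)   = go _ (below v<m) v∈Dom
      rest : AllMonomials (Spanned ∘ mono) (erase m (g index))
      rest = All.map lower-spanned (All.zip (AllP.filter⁺ _ lower , AllP.all-filter _ (g index)))

  spanned-homogeneous : ∀ {k} → (∀ {m} → OfDegree k m → Spanned (mono m)) →
                        ∀ {p} → Homogeneous k p → Spanned p
  spanned-homogeneous {k} monomials {p} homogeneous =
    spanned-≈ p≈filtered (spanned-terms (All.map monomials (AllP.all-filter (degree? ∘ proj₂) p)))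
    where
    degree? : Decidable (OfDegree {suc ℓ} k)
    degree? v = Vec.sum v ℕ.≟ k
    p≈filtered : p ≈P filter (degree? ∘ proj₂) p
    p≈filtered u with degree? u
    ... | yes u-deg = sym (coeff-filter degree? p u-deg)
    ... | no  u-deg = trans p[u]≡0 (sym (coeff-absent (All.map (λ v-deg v≡u → u-deg (subst (OfDegree k) v≡u v-deg))
                                                         (AllP.all-filter (degree? ∘ proj₂) p))))
      where
      p[u]≡0 : coeff p u ≡ 0ℤ
      p[u]≡0 with coeff p u ℤ.≟ 0ℤ
      ... | yes p[u]≡0 = p[u]≡0
      ... | no  p[u]≢0 = ⊥-elim (u-deg (homogeneous u p[u]≢0))

det-cong : ∀ {ℓ} n {M N : Fin n → Fin n → Poly ℓ} → (∀ r c → M r c ≡ N r c) → det n M ≡ det n N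
det-cong zero    M≡N = refl
det-cong (suc n) M≡N = cong sumP (LP.map-cong (λ j →
  cong₂ (λ a b → scale (sgn (toℕ j)) (a *P b)) (M≡N Fin.zero j) (det-cong n (λ r c → M≡N (Fin.suc r) (punchIn j c))))
  (allFin (suc n)))

det-zero-column : ∀ {ℓ} n (M : Fin n → Fin n → Poly ℓ) c₀ → (∀ r → M r c₀ ≡ []) → det n M ≡ []
det-zero-column (suc n) M c₀ zero-column = sumP-[] (allFin (suc n))
  where
  *P-[] : ∀ (p : Poly _) → p *P [] ≡ []
  *P-[] []      = refl
  *P-[] (_ ∷ p) = *P-[] p
  cofactor : Fin (suc n) → Poly _
  cofactor j = det n (λ r c → M (Fin.suc r) (punchIn j c))
  term-[] : ∀ j → scale (sgn (toℕ j)) (M Fin.zero j *P cofactor j) ≡ []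
  term-[] j with j Fin.≟ c₀
  ... | yes refl = cong (λ a → scale (sgn (toℕ j)) (a *P cofactor j)) (zero-column Fin.zero)
  ... | no  j≢c₀ = trans (cong (λ d → scale (sgn (toℕ j)) (M Fin.zero j *P d)) cofactor-[])
                         (cong (scale (sgn (toℕ j))) (*P-[] (M Fin.zero j)))
    where
    cofactor-[] : cofactor j ≡ []
    cofactor-[] = det-zero-column n _ (punchOut j≢c₀)
      (λ r → trans (cong (M (Fin.suc r)) (FinP.punchIn-punchOut j≢c₀)) (zero-column (Fin.suc r)))
  sumP-[] : ∀ js → sumP (map (λ j → scale (sgn (toℕ j)) (M Fin.zero j *P cofactor j)) js) ≡ []
  sumP-[] []       = refl
  sumP-[] (j ∷ js) = cong₂ _++_ (term-[] j) (sumP-[] js)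

det-degree : ∀ {ℓ} n (M : Fin n → Fin n → Poly ℓ) → (∀ r c → AllMonomials (OfDegree 1) (M r c)) →
             AllMonomials (OfDegree n) (det n M)
det-degree {ℓ} zero    M _       = sum-replicate-0 (suc ℓ) ∷ []
det-degree     (suc n) M degrees = AllMonomials-sum-allFin λ j →
  AllMonomials-scale (sgn (toℕ j))
    (AllMonomials-*P (degrees Fin.zero j) (det-degree n _ (λ r c → degrees (Fin.suc r) (punchIn j c)))
                     (λ {u} {v} u-deg v-deg → trans (sum-· u v) (cong₂ _+_ u-deg v-deg)))

-- Minors of R(k,ℓ)

-- R k ℓ i c unfolds to entry ℓ (toℕ i) (toℕ c), so minor k ℓ σ is minorℕ k ℓ (toℕ ∘ σ) by definition.
entry : (ℓ r c : ℕ) → Poly ℓ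
entry ℓ r c = if (r ≤ᵇ c) ∧ ((c ∸ r) ≤ᵇ ℓ) then var (c ∸ r) else zeroP

minorℕ : (n ℓ : ℕ) → (Fin n → ℕ) → Poly ℓ
minorℕ n ℓ τ = det n (λ r c → entry ℓ (toℕ r) (τ c))

tailMinor : (n ℓ : ℕ) → (Fin n → ℕ) → Poly ℓ
tailMinor n ℓ τ = det n (λ r c → entry ℓ (suc (toℕ r)) (τ c))

laplaceTerm : (n ℓ : ℕ) → (Fin (suc n) → ℕ) → Fin (suc n) → Poly ℓ
laplaceTerm n ℓ τ j = scale (sgn (toℕ j)) (entry ℓ 0 (τ j) *P tailMinor n ℓ (τ ∘ punchIn j))

entry-suc : ∀ ℓ r c → 1 ≤ c → entry ℓ (suc r) c ≡ entry ℓ r (c ∸ 1)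
entry-suc ℓ zero    (suc c) _ = refl
entry-suc ℓ (suc r) (suc c) _ = refl

≤ᵇ≡true⇒≤ : ∀ {m n} → (m ≤ᵇ n) ≡ true → m ≤ n
≤ᵇ≡true⇒≤ {m} {n} eq = ℕP.≤ᵇ⇒≤ m n (subst T (sym eq) _)

entry-degree : ∀ ℓ r c → AllMonomials (OfDegree 1) (entry ℓ r c)
entry-degree ℓ r c with r ≤ᵇ c | (c ∸ r) ≤ᵇ ℓ in d≤ℓ
... | false | _     = []
... | true  | false = []
... | true  | true  =
  subst (OfDegree 1) (sym (tabulate≡unit (c ∸ r))) (sum-unit (c ∸ r) (s≤s (≤ᵇ≡true⇒≤ d≤ℓ))) ∷ []

entry-row0 : ∀ ℓ c → AllMonomials (λ u → c ≤ ℓ × u ≡ unit c) (entry ℓ 0 c)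
entry-row0 ℓ c with c ≤ᵇ ℓ in c≤ℓ
... | false = []
... | true  = (≤ᵇ≡true⇒≤ c≤ℓ , tabulate≡unit c) ∷ []

entry-row0≡ : ∀ ℓ c → c ≤ ℓ → entry ℓ 0 c ≡ mono (unit c)
entry-row0≡ ℓ c c≤ℓ with c ≤ᵇ ℓ | ℕP.≤⇒≤ᵇ c≤ℓ
... | true | _ = var≡mono-unit c

tailMinor-shift : ∀ n ℓ τ → (∀ c → 1 ≤ τ c) → tailMinor n ℓ τ ≡ minorℕ n ℓ (λ c → τ c ∸ 1)
tailMinor-shift n ℓ τ positive = det-cong n (λ r c → entry-suc ℓ (toℕ r) (τ c) (positive c))

minor-degree : ∀ k ℓ σ → AllMonomials (OfDegree k) (minor k ℓ σ)
minor-degree k ℓ σ = det-degree k _ (λ r c → entry-degree ℓ (toℕ r) (toℕ (σ c)))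

-- If t is the smallest column, the Laplace term through column t has the factor x_t; every other
-- term has a cofactor on rows 1, 2, … that still contains column t, with entries x_{t−r} there
-- (all zero if t = 0).
mutual
  minorℕ-usesVarBelow : ∀ {ℓ} n (τ : Fin n → ℕ) {t} → (∀ c → t ≤ τ c) → (∃ λ c₀ → τ c₀ ≡ t) →
                        AllMonomials (UsesVarBelow (suc t)) (minorℕ n ℓ τ)
  minorℕ-usesVarBelow {ℓ} (suc n) τ {t} bound (c₀ , τc₀≡t) = AllMonomials-sum-allFin term
    where
    term : ∀ j → AllMonomials (UsesVarBelow (suc t)) (laplaceTerm n ℓ τ j)
    term j with j Fin.≟ c₀
    ... | yes refl = AllMonomials-scale (sgn (toℕ j)) (AllMonomials-*P (entry-row0 ℓ (τ j)) (All.universal (λ _ → tt) _)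
          λ { {v = v} (τj≤ℓ , refl) _ → subst (λ s → UsesVarBelow (suc s) (unit (τ j) · v)) τc₀≡t
                                          (usesVarBelow-unit· (τ j) v (s≤s τj≤ℓ)) })
    ... | no  j≢c₀ = AllMonomials-scale (sgn (toℕ j)) (AllMonomials-*P (All.universal (λ _ → tt) (entry ℓ 0 (τ j)))
          (tailMinor-usesVarBelow n (τ ∘ punchIn j) (bound ∘ punchIn j)
            (punchOut j≢c₀ , trans (cong τ (FinP.punchIn-punchOut j≢c₀)) τc₀≡t))
          λ {u} {v} _ below-t → usesVarBelow-·ʳ u {v} (usesVarBelow-≤ {v = v} (ℕP.n≤1+n t) below-t))

  tailMinor-usesVarBelow : ∀ {ℓ} n (τ : Fin n → ℕ) {t} → (∀ c → t ≤ τ c) → (∃ λ c₀ → τ c₀ ≡ t) →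
                           AllMonomials (UsesVarBelow t) (tailMinor n ℓ τ)
  tailMinor-usesVarBelow {ℓ} n τ {zero} _ (c₀ , τc₀≡0) =
    subst (AllMonomials (UsesVarBelow 0)) (sym (det-zero-column n _ c₀ λ r → cong (entry ℓ (suc (toℕ r))) τc₀≡0)) []
  tailMinor-usesVarBelow {ℓ} n τ {suc t} bound (c₀ , τc₀≡1+t) =
    subst (AllMonomials (UsesVarBelow (suc t))) (sym (tailMinor-shift n ℓ τ (λ c → ℕP.≤-trans (s≤s z≤n) (bound c))))
      (minorℕ-usesVarBelow n (λ c → τ c ∸ 1) (λ c → ℕP.∸-monoˡ-≤ 1 (bound c)) (c₀ , cong (_∸ 1) τc₀≡1+t))

lowerTail : ∀ {n} → (Fin (suc n) → ℕ) → Fin n → ℕ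
lowerTail τ c = τ (Fin.suc c) ∸ 1

-- τ strictly increasing with τ c ∸ c ≤ ℓ: all diagonal entries x_{τ c ∸ c} of the minor on τ
-- are nonzero.  lowerTail τ is the column set of the minor obtained by deleting the first row
-- and column, renumbered.
Admissible : ℕ → ∀ n → (Fin n → ℕ) → Set
Admissible ℓ zero    τ = ⊤
Admissible ℓ (suc n) τ = τ Fin.zero ≤ ℓ × (∀ c → τ Fin.zero < τ (Fin.suc c)) × Admissible ℓ n (lowerTail τ)

diagonal : ∀ {ℓ} n → (Fin n → ℕ) → Mono ℓ
diagonal zero    τ = replicate _ 0
diagonal (suc n) τ = unit (τ Fin.zero) · diagonal n (lowerTail τ)

admissible-min : ∀ {ℓ} n τ → Admissible ℓ (suc n) τ → ∀ c → τ Fin.zero ≤ τ c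
admissible-min n τ _                    Fin.zero    = ℕP.≤-refl
admissible-min n τ (_ , increasing , _) (Fin.suc c) = ℕP.<⇒≤ (increasing c)

admissible-bound : ∀ {ℓ} n τ → Admissible ℓ n τ → ∀ c → τ c < n + ℓ
admissible-bound {ℓ} (suc n) τ (τ₀≤ℓ , _ , _) Fin.zero = s≤s (ℕP.≤-trans τ₀≤ℓ (ℕP.m≤n+m ℓ n))
admissible-bound (suc n) τ (_ , increasing , tail) (Fin.suc c) with τ (Fin.suc c) | increasing c | admissible-bound n _ tail c
... | suc τc | _ | τc<n+ℓ = s≤s τc<n+ℓ

admissible-increasing : ∀ {ℓ} n τ → Admissible ℓ n τ → ∀ i j → toℕ i < toℕ j → τ i < τ j
admissible-increasing (suc n) τ (_ , increasing , _) Fin.zero (Fin.suc j) _ = increasing j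
admissible-increasing (suc n) τ (_ , increasing , tail) (Fin.suc i) (Fin.suc j) (s≤s i<j)
  with τ (Fin.suc i) | increasing i | τ (Fin.suc j) | increasing j | admissible-increasing n _ tail i j i<j
... | suc τi | _ | suc τj | _ | τi<τj = s≤s τi<τj

diagonal-degree : ∀ {ℓ} n τ → Admissible ℓ n τ → OfDegree n (diagonal {ℓ} n τ)
diagonal-degree {ℓ} zero    τ _                 = sum-replicate-0 (suc ℓ)
diagonal-degree {ℓ} (suc n) τ (τ₀≤ℓ , _ , tail) =
  trans (sum-· (unit (τ Fin.zero)) (diagonal {ℓ} n (lowerTail τ)))
        (cong₂ _+_ (sum-unit (τ Fin.zero) (s≤s τ₀≤ℓ)) (diagonal-degree n (lowerTail τ) tail))

diagonal-zero-below : ∀ {ℓ t} n τ → Admissible ℓ n τ → (∀ c → t ≤ τ c) →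
                      ∀ i → toℕ i < t → lookup (diagonal {ℓ} n τ) i ≡ 0
diagonal-zero-below zero    τ _ _ i _ = VecP.lookup-replicate i 0
diagonal-zero-below (suc n) τ (_ , increasing , tail) bound i i<t
  rewrite VecP.lookup-zipWith _+_ i (unit (τ Fin.zero)) (diagonal n (lowerTail τ))
        | lookup-unit-< (τ Fin.zero) i (ℕP.<-≤-trans i<t (bound Fin.zero))
  = diagonal-zero-below n _ tail (λ c → tail-bound (τ (Fin.suc c)) (ℕP.≤-<-trans (bound Fin.zero) (increasing c))) i i<t
  where
  tail-bound : ∀ {t} x → t < x → t ≤ x ∸ 1
  tail-bound (suc x) (s≤s t≤x) = t≤x

laplaceTerm-zero : ∀ {ℓ} n τ → Admissible ℓ (suc n) τ →
                   laplaceTerm n ℓ τ Fin.zero ≡ scale 1ℤ (mono (unit (τ Fin.zero)) *P minorℕ n ℓ (lowerTail τ))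
laplaceTerm-zero {ℓ} n τ (τ₀≤ℓ , increasing , _) =
  cong₂ (λ a b → scale 1ℤ (a *P b)) (entry-row0≡ ℓ (τ Fin.zero) τ₀≤ℓ)
        (tailMinor-shift n ℓ (τ ∘ Fin.suc) (λ c → ℕP.≤-<-trans z≤n (increasing c)))

laplaceTerm-above : ∀ {ℓ n} B τ → Admissible ℓ (suc n) τ → suc n < B → (j : Fin n) →
                    AllMonomials (λ v → enc B (diagonal {ℓ} (suc n) τ) < enc B v) (laplaceTerm n ℓ τ (Fin.suc j))
laplaceTerm-above {ℓ} {suc n} B τ adm n<B j =
  AllMonomials-scale (sgn (toℕ (Fin.suc j))) (AllMonomials-*P (All.universal (λ _ → tt) (entry ℓ 0 (τ (Fin.suc j))))
    (tailMinor-usesVarBelow (suc n) (τ ∘ punchIn (Fin.suc j)) (λ c → τ₀-min (punchIn (Fin.suc j) c)) (Fin.zero , refl))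
    λ {u} {v} _ below → enc-<-usesVarBelow B D (u · v) digits (diagonal-zero-below (suc (suc n)) τ adm τ₀-min)
                                             (usesVarBelow-·ʳ u {v} below))
  where
  D : Mono ℓ
  D = diagonal (suc (suc n)) τ
  τ₀-min : ∀ c → τ Fin.zero ≤ τ c
  τ₀-min = admissible-min (suc n) τ adm
  digits : ∀ i → lookup D i < B
  digits = digits-< D (diagonal-degree (suc (suc n)) τ adm) n<B

minorℕ-leading-terms : ∀ {ℓ} B n τ → Admissible ℓ n τ → n < B →
                       AllMonomials (λ v → v ≡ diagonal n τ ⊎ enc B (diagonal {ℓ} n τ) < enc B v) (minorℕ n ℓ τ)
minorℕ-leading-terms B zero    τ _   _   = inj₁ refl ∷ []
minorℕ-leading-terms {ℓ} B (suc n) τ adm n<B = AllMonomials-sum-allFin term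
  where
  Leading : Mono ℓ → Set
  Leading v = v ≡ diagonal (suc n) τ ⊎ enc B (diagonal (suc n) τ) < enc B v
  D : Mono ℓ
  D = diagonal n (lowerTail τ)
  extend : ∀ {u v} → u ≡ unit (τ Fin.zero) → v ≡ D ⊎ enc B D < enc B v → Leading (u · v)
  extend refl (inj₁ refl) = inj₁ refl
  extend {u} {v} refl (inj₂ D<v) =
    inj₂ (subst₂ _<_ (sym (enc-· B u D)) (sym (enc-· B u v)) (ℕP.+-monoʳ-< (enc B u) D<v))
  term : ∀ j → AllMonomials Leading (laplaceTerm n ℓ τ j)
  term Fin.zero    = subst (AllMonomials Leading) (sym (laplaceTerm-zero n τ adm))
    (AllMonomials-scale 1ℤ (AllMonomials-*P {P = _≡ unit (τ Fin.zero)} {p = mono (unit (τ Fin.zero))} (refl ∷ [])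
                             (minorℕ-leading-terms B n (lowerTail τ) (proj₂ (proj₂ adm)) (ℕP.<⇒≤ n<B)) extend))
  term (Fin.suc j) = All.map inj₂ (laplaceTerm-above B τ adm n<B j)

minorℕ-leading-coeff : ∀ {ℓ} n τ → Admissible ℓ n τ → coeff (minorℕ n ℓ τ) (diagonal n τ) ≡ 1ℤ
minorℕ-leading-coeff {ℓ} zero τ _ with replicate (suc ℓ) 0 ≟M replicate (suc ℓ) 0
... | yes _ = refl
... | no ≢  = ⊥-elim (≢ refl)
minorℕ-leading-coeff {ℓ} (suc n) τ adm = begin
    coeff (laplaceTerm n ℓ τ Fin.zero ++ rest) D              ≡⟨ coeff-++ (laplaceTerm n ℓ τ Fin.zero) rest D ⟩
    coeff (laplaceTerm n ℓ τ Fin.zero) D ℤ.+ coeff rest D     ≡⟨ cong₂ ℤ._+_ first (coeff-absent rest-above) ⟩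
    1ℤ ℤ.+ 0ℤ                                                 ∎
  where
  open ≡-Reasoning
  D : Mono ℓ
  D = diagonal (suc n) τ
  rest : Poly ℓ
  rest = sumP (map (laplaceTerm n ℓ τ) (List.tabulate Fin.suc))
  rest-above : AllMonomials (_≢ D) rest
  rest-above = AllP.concat⁺ (AllP.map⁺ (AllP.tabulate⁺ λ j →
    All.map (λ D<v v≡D → ℕP.<⇒≢ D<v (cong (enc (suc (suc n))) (sym v≡D)))
            (laplaceTerm-above (suc (suc n)) τ adm ℕP.≤-refl j)))
  first : coeff (laplaceTerm n ℓ τ Fin.zero) D ≡ 1ℤ
  first = begin
      coeff (laplaceTerm n ℓ τ Fin.zero) D
        ≡⟨ cong (λ p → coeff p D) (laplaceTerm-zero n τ adm) ⟩
      coeff (scale 1ℤ (mono (unit (τ Fin.zero)) *P minorℕ n ℓ (lowerTail τ))) D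
        ≡⟨ coeff-scale 1ℤ (mono (unit (τ Fin.zero)) *P minorℕ n ℓ (lowerTail τ)) D ⟩
      1ℤ ℤ.* coeff (mono (unit (τ Fin.zero)) *P minorℕ n ℓ (lowerTail τ)) D
        ≡⟨ ℤP.*-identityˡ _ ⟩
      coeff (mono (unit (τ Fin.zero)) *P minorℕ n ℓ (lowerTail τ)) D
        ≡⟨ coeff-mono-*P (unit (τ Fin.zero)) (minorℕ n ℓ (lowerTail τ)) (diagonal n (lowerTail τ)) ⟩
      coeff (minorℕ n ℓ (lowerTail τ)) (diagonal n (lowerTail τ))
        ≡⟨ minorℕ-leading-coeff n (lowerTail τ) (proj₂ (proj₂ adm)) ⟩
      1ℤ ∎

DiagonalColumns : ∀ {ℓ} → ℕ → Mono ℓ → ℕ → Set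
DiagonalColumns {ℓ} k m t = Σ (Fin k → ℕ) λ τ → Admissible ℓ k τ × diagonal k τ ≡ m × (∀ c → t ≤ τ c)

diagonal-surjective : ∀ {ℓ} k (m : Mono ℓ) t → OfDegree k m → (∀ i → toℕ i < t → lookup m i ≡ 0) →
                      DiagonalColumns k m t
diagonal-surjective zero m t m-deg _ = (λ ()) , tt , sym (sum≡0⇒replicate-0 m m-deg) , λ ()
diagonal-surjective {ℓ} (suc k) m t m-deg zeros with peel-lowest m (subst (0 <_) (sym m-deg) (s≤s z≤n))
... | b , w , m≡ , m[b]>0 , w-zeros = extend (diagonal-surjective k w (toℕ b) w-deg w-zeros)
  where
  open ≡-Reasoning
  w-deg : OfDegree k w
  w-deg = ℕP.suc-injective (begin
    suc (Vec.sum w)                              ≡⟨ cong (_+ Vec.sum w) (sum-unit (toℕ b) (FinP.toℕ<n b)) ⟨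
    Vec.sum (unit {suc ℓ} (toℕ b)) + Vec.sum w   ≡⟨ sum-· (unit (toℕ b)) w ⟨
    Vec.sum (unit (toℕ b) · w)                   ≡⟨ cong Vec.sum m≡ ⟨
    Vec.sum m                                    ≡⟨ m-deg ⟩
    suc k                                        ∎)
  t≤b : t ≤ toℕ b
  t≤b = ℕP.≮⇒≥ (λ b<t → ℕP.<⇒≢ m[b]>0 (sym (zeros b b<t)))
  extend : DiagonalColumns k w (toℕ b) → DiagonalColumns (suc k) m t
  extend (τ′ , adm′ , diagonal≡w , τ′≥b) =
    τ , (ℕP.≤-pred (FinP.toℕ<n b) , (λ c → s≤s (τ′≥b c)) , adm′) ,
    trans (cong (unit (toℕ b) ·_) diagonal≡w) (sym m≡) , τ≥t
    where
    τ : Fin (suc k) → ℕ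
    τ Fin.zero    = toℕ b
    τ (Fin.suc c) = suc (τ′ c)
    τ≥t : ∀ c → t ≤ τ c
    τ≥t Fin.zero    = t≤b
    τ≥t (Fin.suc c) = ℕP.m≤n⇒m≤1+n (ℕP.≤-trans t≤b (τ′≥b c))

rank : ∀ {ℓ} → ℕ → Mono ℓ → ℕ
rank {ℓ} k v = suc k ^ suc ℓ ∸ enc (suc k) v

rank-< : ∀ {ℓ} k {m v : Mono ℓ} → OfDegree k v → enc (suc k) m < enc (suc k) v → rank k v < rank k m
rank-< k {v = v} v-deg m<v = ℕP.∸-monoʳ-< m<v (ℕP.<⇒≤ (enc-bound (suc k) v (digits-< v v-deg ℕP.≤-refl)))

minor-pivot : ∀ ℓ k {m : Mono ℓ} → OfDegree k m → Span.Pivot (minor k ℓ) StrictlyIncreasing (OfDegree k) (rank k) m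
minor-pivot ℓ k {m} m-deg with diagonal-surjective k m 0 m-deg (λ _ ())
... | τ , adm , diagonal≡m , _ = record
  { index   = σ
  ; allowed = λ i j i<j → subst₂ _<_ (sym (σ≗τ i)) (sym (σ≗τ j)) (admissible-increasing k τ adm i j i<j)
  ; leading = subst₂ (λ p u → coeff p u ≡ 1ℤ) (sym minor≡) diagonal≡m (minorℕ-leading-coeff k τ adm)
  ; lower   = All.zipWith (λ (v-deg , leading) → v-deg , lower-rank v-deg leading)
                (minor-degree k ℓ σ ,
                 subst (AllMonomials _) (sym minor≡) (minorℕ-leading-terms (suc k) k τ adm ℕP.≤-refl))
  }
  where
  σ : Fin k → Fin (k + ℓ)
  σ c = Fin.fromℕ< (admissible-bound k τ adm c)
  σ≗τ : ∀ c → toℕ (σ c) ≡ τ c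
  σ≗τ c = FinP.toℕ-fromℕ< (admissible-bound k τ adm c)
  minor≡ : minor k ℓ σ ≡ minorℕ k ℓ τ
  minor≡ = det-cong k (λ r c → cong (entry ℓ (toℕ r)) (σ≗τ c))
  lower-rank : ∀ {v} → OfDegree k v → v ≡ diagonal k τ ⊎ enc (suc k) (diagonal k τ) < enc (suc k) v →
               v ≡ m ⊎ rank k v < rank k m
  lower-rank _ (inj₁ v≡diagonal) = inj₁ (trans v≡diagonal diagonal≡m)
  lower-rank {v} v-deg (inj₂ diagonal<v) =
    inj₂ (subst (λ d → rank k v < rank k d) diagonal≡m (rank-< k {diagonal k τ} {v} v-deg diagonal<v))

lemma5p1 : (ℓ k : ℕ) → 1 ≤ k →
    ((σ : Fin k → Fin (k + ℓ)) → StrictlyIncreasing σ → Homogeneous k (minor k ℓ σ))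
    × ((p : Poly ℓ) → Homogeneous k p →
        ∃ λ (cs : List (ℤ × (Fin k → Fin (k + ℓ)))) →
          All (λ c → StrictlyIncreasing (proj₂ c)) cs
          × (p ≈P sumP (map (λ c → scale (proj₁ c) (minor k ℓ (proj₂ c))) cs)))
lemma5p1 ℓ k _ = (λ σ _ → allMonomials⇒homogeneous (minor-degree k ℓ σ)) , λ p homogeneous →
  let spanned cs allowed p≈cs = spanned-homogeneous monomials-spanned {p} homogeneous
  in  cs , allowed , p≈cs
  where
  open Span (minor k ℓ) StrictlyIncreasing
  monomials-spanned : ∀ {m} → OfDegree k m → Spanned (mono m)
  monomials-spanned = spanned-by-pivots (OfDegree k) (rank k) (minor-pivot ℓ k)
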